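{- Let $A$ be a setoid, $B$ a setoid family over $A$ and $(C,a_C)$ a $P_B$-algebra. For every $w:W$ and $F:\mathsf{CohMaps}\,w$, the function $\mathsf{recst}\,w\,F$ given by $s\mapsto a_C\bigl(\mathsf{n}(\mathsf{b}\,w\,s),(F\,s)\circ e_{\mathsf{b}ws}\bigr)$ is an extensional function $\mathsf{ImS}\,w\Rightarrow C$. Moreover, for every $w,w':W$, $\gamma:w\approx_Ww'$, $F:\mathsf{CohMaps}\,w$ and $F':\mathsf{CohMaps}\,w'$: if for every $s:\mathsf{ImS}\,w$ one has $F\,s\approx(F'\,(\mathsf{ImS}_\gamma\,s))\circ\mathsf{ImS}_{\delta_s}$, where $\delta_s:\mathsf{b}\,w\,s\approx_W\mathsf{b}\,w'\,(\mathsf{ImS}_\gamma\,s)$, then $\mathsf{recst}\,w\,F\approx(\mathsf{recst}\,w'\,F')\circ\mathsf{ImS}_\gamma$.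
   Context: Setting: intensional Martin-Löf type theory with $\Pi$-types and a universe $\mathsf{U}$ closed under $\Pi$ and containing intensional $\Sigma$-types, identity types, the unit type, W-types and dependent W-types; logic is propositions-as-types. A setoid $X$ is a tuple $(X_0,\approx_X,r_X,s_X,t_X)$ with $X_0:\mathsf{U}$, $\approx_X:X_0\to X_0\to\mathsf{U}$ and witnesses of reflexivity, symmetry, transitivity; $x:X$ means $x:X_0$. An extensional function $f:X\Rightarrow Y$ is $f_0:X_0\to Y_0$ with a proof of $\prod_{x,x'}x\approx x'\to f_0x\approx f_0x'$; the setoid $X\Rightarrow Y$ has $f\approx g:=\prod_x f_0x\approx g_0x$. A setoid family $B$ over a setoid $A$ gives a setoid $B\,a$ (underlying type $B_0a$) for $a:A$ and extensional transports $B_\alpha:B\,a\Rightarrow B\,a'$ for $\alpha:a\approx_Aa'$, functorial up to $\approx$, with $B_\alpha\approx B_{\alpha'}$ for all $\alpha,\alpha':a\approx a'$. Write $b\approx_\alpha b'$ for $B_\alpha b\approx b'$. $P_BX$ is the setoid on $\sum_{a:A_0}(B\,a\Rightarrow X)$ with $(a,k)\approx(a',k'):=\sum_{\alpha:a\approx a'}k\approx k'\circ B_\alpha$. A $P_B$-algebra is a setoid $C$ with extensional $a_C:P_BC\Rightarrow C$. $\mathrm{W}$ is the W-type on $A_0,B_0$ with constructor $\mathsf{sup}$, and $\mathsf{n}(\mathsf{sup}\,a\,f)\equiv a$, $\mathsf{b}(\mathsf{sup}\,a\,f)\equiv f$. $\mathcal{W}_B$ is the inductive family on $\mathrm{W}\times\mathrm{W}$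 with single constructor $\mathsf{dsup}\,(w,w')\,\alpha\,\phi:\mathcal{W}_B\,w\,w'$ for $\alpha:\mathsf{n}w\approx_A\mathsf{n}w'$ and $\phi:\prod_{(b,b',\beta):\sum_{b,b'}b\approx_\alpha b'}\mathcal{W}_B(\mathsf{b}\,w\,b)(\mathsf{b}\,w'\,b')$. The setoid $W$ has underlying type $\sum_w\mathcal{W}_B\,w\,w$ and $(w,\_)\approx_W(w',\_):=\mathcal{W}_B\,w\,w'$. For $\gamma:w\approx_Ww'$, $\mathsf{n}\triangleright\gamma:\mathsf{n}w\approx_A\mathsf{n}w'$ is its label component; each $\mathsf{b}\,w:B(\mathsf{n}w)\Rightarrow W$ is extensional. For $w:W$, $\mathsf{ImS}\,w$ (immediate subtrees) is the setoid on $B_0(\mathsf{n}w)$ with $s\approx s':=\mathsf{b}\,w\,s\approx_W\mathsf{b}\,w\,s'$; for $\gamma:w\approx_Ww'$, $\mathsf{ImS}_\gamma:=B_{\mathsf{n}\triangleright\gamma}:\mathsf{ImS}\,w\Rightarrow\mathsf{ImS}\,w'$. $e_w:B(\mathsf{n}w)\Rightarrow\mathsf{ImS}\,w$ is the identity on underlying types. $\mathsf{CohMaps}\,w$ is the setoid of families $F:\prod_{s:\mathsf{ImS}\,w}\mathsf{ImS}(\mathsf{b}\,w\,s)\Rightarrow C$ that are coherent: $F\,s\approx(F\,s')\circ\mathsf{ImS}_\sigma$ for all $s,s'$ and $\sigma:\mathsf{b}\,w\,s\approx_W\mathsf{b}\,w\,s'$; equality is pointwise. -}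

module Defs where

open import Data.Product using (Σ; _,_; proj₁; proj₂; Σ-syntax)

-- The universe U of the paper is rendered as Agda's Set.

record Setoid : Set₁ where
  field
    Car   : Set
    _≈_   : Car → Car → Set
    rfl   : (x : Car) → x ≈ x
    sym   : {x y : Car} → x ≈ y → y ≈ x
    trans : {x y z : Car} → x ≈ y → y ≈ z → x ≈ z

open Setoid public using (Car)

infixr 1 _⇒_
record _⇒_ (X Y : Setoid) : Set where
  constructor mkExt
  field
    ap  : Car X → Car Y
    ext : {x x' : Car X} → Setoid._≈_ X x x' → Setoid._≈_ Y (ap x) (ap x')

open _⇒_ public

_≈F_ : {X Y : Setoid} → (f g : X ⇒ Y) → Set
_≈F_ {X} {Y} f g = (x : Car X) → Setoid._≈_ Y (ap f x) (ap g x)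

_⇒S_ : Setoid → Setoid → Setoid
X ⇒S Y = record
  { Car = X ⇒ Y
  ; _≈_ = _≈F_
  ; rfl = λ f x → Setoid.rfl Y (ap f x)
  ; sym = λ p x → Setoid.sym Y (p x)
  ; trans = λ p q x → Setoid.trans Y (p x) (q x)
  }

idE : {X : Setoid} → X ⇒ X
idE = mkExt (λ x → x) (λ p → p)

infixr 9 _∘E_
_∘E_ : {X Y Z : Setoid} → Y ⇒ Z → X ⇒ Y → X ⇒ Z
g ∘E f = mkExt (λ x → ap g (ap f x)) (λ p → ext g (ext f p))

record Fam (A : Setoid) : Set₁ where
  field
    Fib    : Car A → Setoid
    tr     : {a a' : Car A} → Setoid._≈_ A a a' → Fib a ⇒ Fib a'
    tr-id  : (a : Car A) → tr (Setoid.rfl A a) ≈F idE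
    tr-cmp : {a a' a'' : Car A} (α : Setoid._≈_ A a a') (β : Setoid._≈_ A a' a'')
             → tr (Setoid.trans A α β) ≈F (tr β ∘E tr α)
    tr-irr : {a a' : Car A} (α α' : Setoid._≈_ A a a') → tr α ≈F tr α'

module Theory (A : Setoid) (B : Fam A) where

  open Fam B
  module A = Setoid A

  B₀ : Car A → Set
  B₀ a = Car (Fib a)

  _≈[_]_ : {a a' : Car A} → B₀ a → Setoid._≈_ A a a' → B₀ a' → Set
  b ≈[ α ] b' = Setoid._≈_ (Fib _) (ap (tr α) b) b'

  tr-inv : {a a' : Car A} (α : a A.≈ a') (x : B₀ a')
         → Setoid._≈_ (Fib a') (ap (tr α) (ap (tr (A.sym α)) x)) x
  tr-inv {a} {a'} α x =
    FS.trans (FS.sym (tr-cmp (A.sym α) α x))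
      (FS.trans (tr-irr (A.trans (A.sym α) α) (A.rfl a') x) (tr-id a' x))
    where module FS = Setoid (Fib a')

  P : Setoid → Setoid
  P X = record
    { Car = Σ[ a ∈ Car A ] (Fib a ⇒ X)
    ; _≈_ = λ { (a , k) (a' , k') → Σ[ α ∈ a A.≈ a' ] (k ≈F (k' ∘E tr α)) }
    ; rfl = λ { (a , k) → A.rfl a , λ x → ext k (FS.sym (Fib a) (tr-id a x)) }
    ; sym = λ { {a , k} {a' , k'} (α , p) →
                A.sym α , λ x → X.trans (ext k' (FS.sym (Fib a') (tr-inv α x)))
                                       (X.sym (p (ap (tr (A.sym α)) x))) }
    ; trans = λ { {a , k} {a' , k'} {a'' , k''} (α , p) (β , q) →
                A.trans α β , λ x → X.trans (p x)
                  (X.trans (q (ap (tr α) x))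
                     (ext k'' (FS.sym (Fib a'') (tr-cmp α β x)))) }
    }
    where
      module X = Setoid X
      module FS = Setoid

  data W₀ : Set where
    sup : (a : Car A) → (B₀ a → W₀) → W₀

  n : W₀ → Car A
  n (sup a f) = a

  b : (w : W₀) → B₀ (n w) → W₀
  b (sup a f) = f

  data 𝒲 : W₀ → W₀ → Set where
    dsup : (w w' : W₀) (α : n w A.≈ n w')
           (φ : (t : Σ[ s ∈ B₀ (n w) ] Σ[ s' ∈ B₀ (n w') ] (s ≈[ α ] s'))
                → 𝒲 (b w (proj₁ t)) (b w' (proj₁ (proj₂ t))))
           → 𝒲 w w'

  lbl : {w w' : W₀} → 𝒲 w w' → n w A.≈ n w'
  lbl (dsup _ _ α _) = α

  sub : {w w' : W₀} (p : 𝒲 w w') (s : B₀ (n w)) (s' : B₀ (n w')) → s ≈[ lbl p ] s'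
        → 𝒲 (b w s) (b w' s')
  sub (dsup _ _ α φ) s s' β = φ (s , s' , β)

  𝒲-sym : {w w' : W₀} → 𝒲 w w' → 𝒲 w' w
  𝒲-sym (dsup w w' α φ) = dsup w' w (A.sym α)
    (λ { (s' , s , β') → 𝒲-sym (φ (s , s' , fix s' s β')) })
    where
      fix : (s' : B₀ (n w')) (s : B₀ (n w)) → s' ≈[ A.sym α ] s → s ≈[ α ] s'
      fix s' s β' = FS.trans (FS.sym (ext (tr α) β')) (tr-inv α s')
        where module FS = Setoid (Fib (n w'))

  𝒲-trans : {w w' w'' : W₀} → 𝒲 w w' → 𝒲 w' w'' → 𝒲 w w''
  𝒲-trans (dsup w w' α φ) (dsup .w' w'' β ψ) = dsup w w'' (A.trans α β)
    (λ { (s , s'' , γ) →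
         𝒲-trans (φ (s , ap (tr α) s , Setoid.rfl (Fib (n w')) (ap (tr α) s)))
                 (ψ (ap (tr α) s , s'' ,
                     Setoid.trans (Fib (n w'')) (Setoid.sym (Fib (n w'')) (tr-cmp α β s)) γ)) })

  W : Setoid
  W = record
    { Car = Σ[ w ∈ W₀ ] 𝒲 w w
    ; _≈_ = λ x y → 𝒲 (proj₁ x) (proj₁ y)
    ; rfl = λ x → proj₂ x
    ; sym = 𝒲-sym
    ; trans = 𝒲-trans
    }

  module W = Setoid W

  nW : Car W → Car A
  nW w = n (proj₁ w)

  n▷ : (w w' : Car W) → w W.≈ w' → nW w A.≈ nW w'
  n▷ w w' γ = lbl γ

  self : (w : Car W) {s s' : B₀ (nW w)} → Setoid._≈_ (Fib (nW w)) s s'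
       → s ≈[ lbl (proj₂ w) ] s'
  self w {s} {s'} e = FS.trans (tr-irr (lbl (proj₂ w)) (A.rfl (nW w)) s)
                        (FS.trans (tr-id (nW w) s) e)
    where module FS = Setoid (Fib (nW w))

  bW₀ : (w : Car W) → B₀ (nW w) → Car W
  bW₀ w s = b (proj₁ w) s , sub (proj₂ w) s s (self w (Setoid.rfl (Fib (nW w)) s))

  bW : (w : Car W) → Fib (nW w) ⇒ W
  bW w = mkExt (bW₀ w) (λ {s} {s'} e → sub (proj₂ w) s s' (self w e))

  ImS : Car W → Setoid
  ImS w = record
    { Car = B₀ (nW w)
    ; _≈_ = λ s s' → bW₀ w s W.≈ bW₀ w s'
    ; rfl = λ s → W.rfl (bW₀ w s)
    ; sym = λ {s} {s'} → W.sym {bW₀ w s} {bW₀ w s'}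
    ; trans = λ {s} {s'} {s''} → W.trans {bW₀ w s} {bW₀ w s'} {bW₀ w s''}
    }

  δ : (w w' : Car W) (γ : w W.≈ w') (s : B₀ (nW w))
    → bW₀ w s W.≈ bW₀ w' (ap (tr (n▷ w w' γ)) s)
  δ w w' γ s = sub γ s (ap (tr (lbl γ)) s) (Setoid.rfl (Fib (nW w')) _)

  ImS-tr : (w w' : Car W) → w W.≈ w' → ImS w ⇒ ImS w'
  ImS-tr w w' γ = mkExt (ap (tr (n▷ w w' γ)))
    (λ {s} {s'} e → W.trans {bW₀ w' (t s)} {bW₀ w s} {bW₀ w' (t s')}
                      (W.sym {bW₀ w s} {bW₀ w' (t s)} (δ w w' γ s))
                      (W.trans {bW₀ w s} {bW₀ w s'} {bW₀ w' (t s')} e (δ w w' γ s')))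
    where
      t : B₀ (nW w) → B₀ (nW w')
      t = ap (tr (n▷ w w' γ))

  e : (w : Car W) → Fib (nW w) ⇒ ImS w
  e w = mkExt (λ s → s) (ext (bW w))

  module _ (C : Setoid) where

    module C = Setoid C

    Coherent : (w : Car W) → ((s : Car (ImS w)) → ImS (bW₀ w s) ⇒ C) → Set
    Coherent w F = (s s' : Car (ImS w)) (σ : bW₀ w s W.≈ bW₀ w s')
                   → F s ≈F (F s' ∘E ImS-tr (bW₀ w s) (bW₀ w s') σ)

    CohMaps : Car W → Setoid
    CohMaps w = record
      { Car = Σ[ F ∈ ((s : Car (ImS w)) → ImS (bW₀ w s) ⇒ C) ] Coherent w F
      ; _≈_ = λ F G → (s : Car (ImS w)) → proj₁ F s ≈F proj₁ G s
      ; rfl = λ F s x → C.rfl _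
      ; sym = λ p s x → C.sym (p s x)
      ; trans = λ p q s x → C.trans (p s x) (q s x)
      }

    recst : (aC : P C ⇒ C) (w : Car W) → Car (CohMaps w) → Car (ImS w) → Car C
    recst aC w F s = ap aC (nW (bW₀ w s) , (proj₁ F s ∘E e (bW₀ w s)))

module Submission where

-- Both halves of Lemma 3.9 are instances of a single fact
-- about one step of the W-recursion: if u ≈_W u' via σ and two maps
-- G : ImS u ⇒ C, G' : ImS u' ⇒ C agree along the transport ImS_σ, then
-- the P_B-elements  (n u, G ∘ e_u)  and  (n u', G' ∘ e_u')  are equal in
-- P_B C, witnessed by the label n ▷ σ together with that agreement
-- (ImS_σ is B_{n ▷ σ} and e is the identity on underlying types, so the
-- agreement is literally the second component required).  Applying the
-- extensional algebra map a_C then relates the corresponding values.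
--   * Extensionality of recst w F: take u, u' = b w s, b w s' and use the
--     coherence of F.
--   * The comparison with F': take u, u' = b w s, b w' (ImS_γ s) related
--     by δ_s and use the hypothesis relating F and F'.

open import Defs
open import Data.Product using (_×_; proj₁; _,_)

module RecursionStep (A : Setoid) (B : Fam A) (C : Setoid) (aC : Theory.P A B C ⇒ C) where
  open Theory A B

  node : (u : Car W) → ImS u ⇒ C → Car (P C)
  node u G = nW u , G ∘E e u

  node-resp : (u u' : Car W) (σ : u W.≈ u') (G : ImS u ⇒ C) (G' : ImS u' ⇒ C)
            → G ≈F (G' ∘E ImS-tr u u' σ)
            → Setoid._≈_ (P C) (node u G) (node u' G')
  node-resp u u' σ G G' agree = n▷ u u' σ , agree

  step-resp : (u u' : Car W) (σ : u W.≈ u') (G : ImS u ⇒ C) (G' : ImS u' ⇒ C)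
            → G ≈F (G' ∘E ImS-tr u u' σ)
            → Setoid._≈_ C (ap aC (node u G)) (ap aC (node u' G'))
  step-resp u u' σ G G' agree = ext aC (node-resp u u' σ G G' agree)

lemma3p9 : (A : Setoid) (B : Fam A) → let open Theory A B in
    (C : Setoid) (aC : P C ⇒ C) →
    ((w : Car W) (F : Car (CohMaps C w)) (s s' : Car (ImS w))
    → Setoid._≈_ (ImS w) s s'
    → Setoid._≈_ C (recst C aC w F s) (recst C aC w F s'))
    × ((w w' : Car W) (γ : Setoid._≈_ W w w')
    (F : Car (CohMaps C w)) (F' : Car (CohMaps C w'))
    → ((s : Car (ImS w))
    → proj₁ F s ≈F (proj₁ F' (ap (ImS-tr w w' γ) s)
    ∘E ImS-tr (bW₀ w s) (bW₀ w' (ap (ImS-tr w w' γ) s)) (δ w w' γ s)))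
    → (s : Car (ImS w))
    → Setoid._≈_ C (recst C aC w F s) (recst C aC w' F' (ap (ImS-tr w w' γ) s)))
lemma3p9 A B C aC = recst-ext , recst-transport
  where
    open Theory A B
    open RecursionStep A B C aC

    recst-ext : (w : Car W) (F : Car (CohMaps C w)) (s s' : Car (ImS w))
              → Setoid._≈_ (ImS w) s s'
              → Setoid._≈_ C (recst C aC w F s) (recst C aC w F s')
    recst-ext w (F , coh) s s' σ =
      step-resp (bW₀ w s) (bW₀ w s') σ (F s) (F s') (coh s s' σ)

    recst-transport : (w w' : Car W) (γ : w W.≈ w')
                      (F : Car (CohMaps C w)) (F' : Car (CohMaps C w'))
                    → ((s : Car (ImS w))
                       → proj₁ F s ≈F (proj₁ F' (ap (ImS-tr w w' γ) s)
                          ∘E ImS-tr (bW₀ w s) (bW₀ w' (ap (ImS-tr w w' γ) s)) (δ w w' γ s)))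
                    → (s : Car (ImS w))
                    → Setoid._≈_ C (recst C aC w F s) (recst C aC w' F' (ap (ImS-tr w w' γ) s))
    recst-transport w w' γ (F , _) (F' , _) agree s =
      step-resp (bW₀ w s) (bW₀ w' s') (δ w w' γ s) (F s) (F' s') (agree s)
      where
        s' : Car (ImS w')
        s' = ap (ImS-tr w w' γ) s
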